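{- Let $s<t$ be relatively prime positive integers. Let $\Delta^1,\dots,\Delta^k$ be pairwise disjoint $(s,t)$-closed delta-sets with $k>2$, such that at least one $\Delta^i$ has width greater than $1$. Let $n=|\Delta^1|+\dots+|\Delta^k|$. Then $h(M\Delta_n)<h(\Delta^1)+\dots+h(\Delta^k)$.
   Context: A beta-set is a finite set of positive integers written decreasingly $\{\beta_1>\dots>\beta_m\}$, with associated partition $P(\beta)=(\beta_1-(m-1),\dots,\beta_m)$. For partitions $P=(P_1,\dots,P_m)$, $Q=(Q_1,\dots,Q_r)$ write $P<Q$ if $m\le r$ and $P_j\le Q_j$ for $j\le m$; $\beta\prec\gamma$ means $P(\beta)<P(\gamma)$. The $(s,t)$-closure of a set $\beta$ of positive integers is $\overline{\beta}=\{x-as-bt: x\in\beta,\ a,b\ge0,\ x>as+bt\}$. A delta-set is a set $\overline{\{g\}}$ with $g$ a positive integer. $M\Delta_n$ denotes the largest (under $\prec$) delta-set with exactly $n$ elements. The width $w(\beta)$ (resp. height $h(\beta)$) is the number of distinct residue classes modulo $s$ (resp. modulo $t$) represented by elements of $\beta$. -}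

module Defs where

open import Data.Nat using (ℕ; zero; suc; _+_; _*_; _∸_; _≤_; _<_; NonZero)
open import Data.Nat.Properties using (_≟_)
open import Data.Nat.DivMod using (_%_)
open import Data.List using (List; []; _∷_; length; map; filter; downFrom; upTo; deduplicate)
open import Data.List.Relation.Unary.Any using (Any; any?)
open import Data.Product using (_×_; ∃-syntax)
open import Data.Unit using (⊤)
open import Data.Empty using (⊥)
open import Relation.Binary.PropositionalEquality using (_≡_)

-- closure{g} = { g - a s - b t : a,b ≥ 0, g > a s + b t }.  Membership of y ∈ {1..g}
-- is tested as ∃ a,b ∈ {0..g}. a s + b t + y = g (y ≥ 1 encodes g > a s + b t;
-- the bound a,b ≤ g is harmless since s,t ≥ 1).
delta : ℕ → ℕ → ℕ → List ℕ
delta s t g = filter (λ y → any? (λ a → any? (λ b → a * s + b * t + y ≟ g) (upTo (suc g))) (upTo (suc g)))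
                     (map suc (downFrom g))

partition : List ℕ → List ℕ
partition [] = []
partition (x ∷ xs) = (x ∸ length xs) ∷ partition xs

PLe : List ℕ → List ℕ → Set
PLe [] _ = ⊤
PLe (p ∷ ps) [] = ⊥
PLe (p ∷ ps) (q ∷ qs) = (p ≤ q) × PLe ps qs

_≺_ : List ℕ → List ℕ → Set
β ≺ γ = PLe (partition β) (partition γ)

residues : (m : ℕ) .{{_ : NonZero m}} → List ℕ → ℕ
residues m β = length (deduplicate _≟_ (map (λ x → x % m) β))

width : (s : ℕ) .{{_ : NonZero s}} → List ℕ → ℕ
width s β = residues s β

height : (t : ℕ) .{{_ : NonZero t}} → List ℕ → ℕ
height t β = residues t β

IsMDelta : ℕ → ℕ → ℕ → ℕ → Set
IsMDelta s t n D =
  (1 ≤ D) × (length (delta s t D) ≡ n) ×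
  ((g : ℕ) → 1 ≤ g → length (delta s t g) ≡ n → delta s t g ≺ delta s t D)

-- Write N(g) for the number of elements of ⟨s, t⟩ below g; then |Δ_g| = N(g), since y ∈ Δ_g
-- iff g - y ∈ ⟨s, t⟩. The elements g - a s (a < t, a s < g) of Δ_g are pairwise incongruent
-- modulo t, so h(Δ_g) < t forces g ≤ h(Δ_g) s; conversely D ≤ m s forces h(Δ_D) ≤ m.
-- A delta-set of width > 1 has g > t. If the heights h_i sum to H > t we are done, as
-- h(Δ_D) ≤ t. Otherwise g_i ≤ h_i s for all i, and N is superadditive on multiples of s,
-- strictly so once a multiple exceeds t; that strict step pays for a loss of one in a third
-- summand, giving n = Σ N(g_i) ≤ N((H - 1) s). Hence D ≤ (H - 1) s and h(Δ_D) ≤ H - 1.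

module Submission where

open import Defs
open import Data.Nat using (ℕ; _<_; _≤_; NonZero)
open import Data.Nat.Coprimality using (Coprime)
open import Data.Fin using (Fin)
open import Data.List using (length; map; allFin)
open import Data.Nat.ListAction using (sum)
open import Data.List.Membership.Propositional using (_∈_)
open import Data.Product using (_×_; ∃-syntax)
open import Data.Empty using (⊥)
open import Relation.Binary.PropositionalEquality using (_≡_; _≢_)

open import Data.Nat using (zero; suc; _+_; _*_; _∸_; pred; z≤n; s≤s; s≤s⁻¹; _<?_; >-nonZero; >-nonZero⁻¹)
open import Data.Nat.Properties
open import Data.Nat.DivMod using (_%_; _/_; m≡m%n+[m/n]*n; m%n<n; [m+kn]%n≡m%n)
open import Data.Nat.Divisibility using (_∣_; divides; ∣-refl; ∣m+n∣m⇒∣n; ∣⇒≤; n∣m*n)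
open import Data.Nat.Coprimality using (coprime-divisor) renaming (sym to Coprime-sym)
open import Data.Nat.Tactic.RingSolver using (solve-∀)
open import Data.List using (List; []; _∷_; _++_; [_]; filter; upTo; downFrom; applyUpTo; deduplicate)
open import Data.List.Properties using (length-applyUpTo; length-upTo; length-map; length-tabulate; map-∘; map-cong)
open import Data.List.Membership.Propositional using (lose)
open import Data.List.Membership.Propositional.Properties
  using (∈-∃++; ∈-upTo⁺; ∈-applyUpTo⁺; ∈-applyUpTo⁻; ∈-map⁺; ∈-map⁻; ∈-downFrom⁺;
         ∈-filter⁺; ∈-filter⁻;
         ∈-deduplicate⁺; ∈-deduplicate⁻; ∈-allFin)
open import Data.List.Relation.Binary.Subset.Propositional using (_⊆_)
open import Data.List.Relation.Binary.Permutation.Propositional using (_↭_; ↭-sym)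
open import Data.List.Relation.Binary.Permutation.Propositional.Properties using (shift; ↭-length; ∈-resp-↭; map⁺)
open import Data.Nat.ListAction.Properties using (sum-↭)
open import Data.List.Relation.Unary.All as All using ()
open import Data.List.Relation.Unary.Any using (Any; any?; here; there; satisfied)
open import Data.List.Relation.Unary.AllPairs using (_∷_)
open import Data.List.Relation.Unary.Unique.Propositional using (Unique)
open import Data.List.Relation.Unary.Unique.Propositional.Properties using (applyUpTo⁺₁)
open import Data.List.Relation.Unary.Unique.DecPropositional.Properties _≟_ using (deduplicate-!)
open import Data.Product using (_,_)
open import Data.Sum using (inj₁; inj₂)
open import Function using (id; _⇔_; mk⇔; Equivalence)
open import Relation.Nullary using (¬_; Dec; yes; no; contradiction)
open import Relation.Nullary.Decidable using (map′)
open import Relation.Unary using (Decidable)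
open import Relation.Binary.PropositionalEquality
  using (refl; sym; trans; cong; cong₂; subst; ≢-sym; module ≡-Reasoning)

module _ {A : Set} where

  private
    length-∷-mid : ∀ (us : List A) {x vs} → length (us ++ x ∷ vs) ≡ suc (length (us ++ vs))
    length-∷-mid [] = refl
    length-∷-mid (_ ∷ us) = cong suc (length-∷-mid us)

    ∈-∷-mid⁻ : ∀ (us : List A) {x y vs} → y ∈ us ++ x ∷ vs → y ≢ x → y ∈ us ++ vs
    ∈-∷-mid⁻ []       (here refl) y≢x = contradiction refl y≢x
    ∈-∷-mid⁻ []       (there y∈)  _   = y∈
    ∈-∷-mid⁻ (_ ∷ us) (here refl) _   = here refl
    ∈-∷-mid⁻ (_ ∷ us) (there y∈)  y≢x = there (∈-∷-mid⁻ us y∈ y≢x)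

  Unique-⊆⇒length≤ : {xs ys : List A} → Unique xs → xs ⊆ ys → length xs ≤ length ys
  Unique-⊆⇒length≤ {[]} _ _ = z≤n
  Unique-⊆⇒length≤ {x ∷ xs} (x∉xs ∷ xs!) xs⊆ys
    with us , vs , refl ← ∈-∃++ (xs⊆ys (here refl)) =
    subst (suc (length xs) ≤_) (sym (length-∷-mid us))
      (s≤s (Unique-⊆⇒length≤ xs! λ y∈xs →
        ∈-∷-mid⁻ us (xs⊆ys (there y∈xs)) (≢-sym (All.lookup x∉xs y∈xs))))

  ∈⇒↭∷ : ∀ {x : A} {xs} → x ∈ xs → ∃[ ys ] xs ↭ x ∷ ys
  ∈⇒↭∷ x∈xs with us , vs , refl ← ∈-∃++ x∈xs = us ++ vs , shift _ us vs

module _ (m : ℕ) .{{_ : NonZero m}} where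

  residues-≤ : ∀ β {ys} → map (_% m) β ⊆ ys → residues m β ≤ length ys
  residues-≤ β β%m⊆ys = Unique-⊆⇒length≤ (deduplicate-! _) λ r∈ → β%m⊆ys (∈-deduplicate⁻ _≟_ _ r∈)

  residues-≥ : ∀ β {xs} → Unique xs → xs ⊆ map (_% m) β → length xs ≤ residues m β
  residues-≥ β xs! xs⊆β%m = Unique-⊆⇒length≤ xs! λ r∈ → ∈-deduplicate⁺ _≟_ (xs⊆β%m r∈)

  residues-≤-modulus : ∀ β → residues m β ≤ m
  residues-≤-modulus β = subst (residues m β ≤_) (length-upTo m)
    (residues-≤ β λ r∈ → let x , _ , r≡x%m = ∈-map⁻ (_% m) r∈ in
                         ∈-upTo⁺ (subst (_< m) (sym r≡x%m) (m%n<n x m)))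

[m+n]%d≡m%d⇒d∣n : ∀ m n d .{{_ : NonZero d}} → (m + n) % d ≡ m % d → d ∣ n
[m+n]%d≡m%d⇒d∣n m n d eq = ∣m+n∣m⇒∣n (divides ((m + n) / d) qd+n≡q'd) (n∣m*n (m / d))
  where
  open ≡-Reasoning
  qd+n≡q'd : m / d * d + n ≡ (m + n) / d * d
  qd+n≡q'd = +-cancelˡ-≡ (m % d) _ _ (begin
    m % d + (m / d * d + n)        ≡⟨ sym (+-assoc (m % d) _ n) ⟩
    m % d + m / d * d + n          ≡⟨ cong (_+ n) (sym (m≡m%n+[m/n]*n m d)) ⟩
    m + n                          ≡⟨ m≡m%n+[m/n]*n (m + n) d ⟩
    (m + n) % d + (m + n) / d * d  ≡⟨ cong (_+ (m + n) / d * d) eq ⟩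
    m % d + (m + n) / d * d        ∎)

indicator : {A : Set} → Dec A → ℕ
indicator (yes _) = 1
indicator (no _)  = 0

indicator-mono : {A B : Set} (a? : Dec A) (b? : Dec B) → (A → B) → indicator a? ≤ indicator b?
indicator-mono (yes a) (yes _) _   = ≤-refl
indicator-mono (yes a) (no ¬b) a→b = contradiction (a→b a) ¬b
indicator-mono (no _)  _       _   = z≤n

indicator-cong : {A B : Set} (a? : Dec A) (b? : Dec B) → A ⇔ B → indicator a? ≡ indicator b?
indicator-cong a? b? A⇔B =
  ≤-antisym (indicator-mono a? b? (Equivalence.to A⇔B)) (indicator-mono b? a? (Equivalence.from A⇔B))

indicator-yes : {A : Set} (a? : Dec A) → A → indicator a? ≡ 1
indicator-yes (yes _) _ = refl
indicator-yes (no ¬a) a = contradiction a ¬a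

indicator-< : {A B : Set} (a? : Dec A) (b? : Dec B) → ¬ A → B → indicator a? < indicator b?
indicator-< (yes a) _       ¬a _ = contradiction a ¬a
indicator-< (no _)  (yes _) _  _ = ≤-refl
indicator-< (no _)  (no ¬b) _  b = contradiction b ¬b

count : {P : ℕ → Set} → Decidable P → ℕ → ℕ
count P? zero    = 0
count P? (suc n) = count P? n + indicator (P? n)

module _ {P Q : ℕ → Set} (P? : Decidable P) (Q? : Decidable Q) where

  count-mono : ∀ n → (∀ {i} → i < n → P i → Q i) → count P? n ≤ count Q? n
  count-mono zero    _   = z≤n
  count-mono (suc n) P⇒Q = +-mono-≤ (count-mono n λ i<n → P⇒Q (m<n⇒m<1+n i<n))
                                     (indicator-mono (P? n) (Q? n) (P⇒Q ≤-refl))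

  count-< : ∀ n {j} → (∀ {i} → i < n → P i → Q i) → j < n → ¬ P j → Q j → count P? n < count Q? n
  count-< (suc n) {j} P⇒Q j<1+n ¬Pj Qj with m≤n⇒m<n∨m≡n (s≤s⁻¹ j<1+n)
  ... | inj₁ j<n  = +-mono-<-≤ (count-< n (λ i<n → P⇒Q (m<n⇒m<1+n i<n)) j<n ¬Pj Qj)
                               (indicator-mono (P? n) (Q? n) (P⇒Q ≤-refl))
  ... | inj₂ refl = +-mono-≤-< (count-mono n λ i<n → P⇒Q (m<n⇒m<1+n i<n)) (indicator-< (P? j) (Q? j) ¬Pj Qj)

count-≡0 : ∀ {P : ℕ → Set} (P? : Decidable P) n → (∀ {i} → i < n → ¬ P i) → count P? n ≡ 0
count-≡0 P? zero    _    = refl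
count-≡0 {P} P? (suc n) none = cong₂ _+_ (count-≡0 P? n λ i<n → none (m<n⇒m<1+n i<n)) (absent (P? n))
  where
  absent : (a? : Dec (P n)) → indicator a? ≡ 0
  absent (yes Pn) = contradiction Pn (none ≤-refl)
  absent (no _)   = refl

count-+ : ∀ {P : ℕ → Set} (P? : Decidable P) m n → count P? (m + n) ≡ count P? m + count (λ i → P? (m + i)) n
count-+ P? m zero    = trans (cong (count P?) (+-identityʳ m)) (sym (+-identityʳ _))
count-+ P? m (suc n) = begin
  count P? (m + suc n)                                               ≡⟨ cong (count P?) (+-suc m n) ⟩
  count P? (m + n) + indicator (P? (m + n))                          ≡⟨ cong (_+ indicator (P? (m + n))) (count-+ P? m n) ⟩
  count P? m + count (λ i → P? (m + i)) n + indicator (P? (m + n))   ≡⟨ +-assoc (count P? m) _ _ ⟩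
  count P? m + count (λ i → P? (m + i)) (suc n)                      ∎
  where open ≡-Reasoning

count-reverse : ∀ {P Q : ℕ → Set} (P? : Decidable P) (Q? : Decidable Q) n →
                (∀ {i} → i < n → P i ⇔ Q (n ∸ suc i)) → count P? n ≡ count Q? n
count-reverse P? Q? zero    _      = refl
count-reverse {P} {Q} P? Q? (suc n) P⇔Qrev = begin
  count P? n + indicator (P? n)                 ≡⟨ cong₂ _+_ (count-reverse P? (λ i → Q? (suc i)) n P⇔Q∘suc)
                                                             (indicator-cong (P? n) (Q? 0) P⇔Q0) ⟩
  count (λ i → Q? (1 + i)) n + indicator (Q? 0) ≡⟨ +-comm _ (indicator (Q? 0)) ⟩
  count Q? 1 + count (λ i → Q? (1 + i)) n       ≡⟨ count-+ Q? 1 n ⟨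
  count Q? (suc n)                              ∎
  where
  open ≡-Reasoning
  P⇔Q0 : P n ⇔ Q 0
  P⇔Q0 = subst (λ j → P n ⇔ Q j) (n∸n≡0 n) (P⇔Qrev ≤-refl)
  P⇔Q∘suc : ∀ {i} → i < n → P i ⇔ Q (suc (n ∸ suc i))
  P⇔Q∘suc {i} i<n = subst (λ j → P i ⇔ Q j) (+-∸-assoc 1 i<n) (P⇔Qrev (m<n⇒m<1+n i<n))

length-filter-downFrom : ∀ {P : ℕ → Set} (P? : Decidable P) n →
                         length (filter P? (map suc (downFrom n))) ≡ count (λ i → P? (suc i)) n
length-filter-downFrom P? zero = refl
length-filter-downFrom P? (suc n) with P? (suc n)
... | yes _ = trans (cong suc (length-filter-downFrom P? n)) (+-comm 1 _)
... | no _  = trans (length-filter-downFrom P? n) (sym (+-identityʳ _))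

module _ {P : ℕ → ℕ → Set} where

  Any²-upTo⁺ : ∀ {n a b} → a ≤ n → b ≤ n → P a b → Any (λ a → Any (P a) (upTo (suc n))) (upTo (suc n))
  Any²-upTo⁺ a≤n b≤n Pab = lose (∈-upTo⁺ (s≤s a≤n)) (lose (∈-upTo⁺ (s≤s b≤n)) Pab)

  Any²⁻ : ∀ {xs ys} → Any (λ a → Any (P a) ys) xs → ∃[ a ] ∃[ b ] P a b
  Any²⁻ p = let a , q = satisfied p in a , satisfied q

module _ (s t : ℕ) .{{_ : NonZero s}} .{{_ : NonZero t}} where

  Rep : ℕ → Set
  Rep x = ∃[ a ] ∃[ b ] a * s + b * t ≡ x

  private
    coefficients-≤ : ∀ {a b g} → a * s + b * t ≤ g → a ≤ g × b ≤ g
    coefficients-≤ {a} {b} ≤g = ≤-trans (≤-trans (m≤m*n a s) (m≤m+n _ _)) ≤g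
                              , ≤-trans (≤-trans (m≤m*n b t) (m≤n+m _ _)) ≤g

    search⁺ : ∀ {a b y g} → a * s + b * t + y ≡ g →
                  Any (λ a → Any (λ b → a * s + b * t + y ≡ g) (upTo (suc g))) (upTo (suc g))
    search⁺ {a} {b} {y} e =
      let a≤g , b≤g = coefficients-≤ {a} {b} (≤-trans (m≤m+n _ y) (≤-reflexive e)) in Any²-upTo⁺ a≤g b≤g e

  Rep? : Decidable Rep
  Rep? x = map′ (λ p → let a , b , e = Any²⁻ p in a , b , trans (sym (+-identityʳ _)) e)
                (λ (a , b , e) → search⁺ {a} {b} (trans (+-identityʳ _) e))
                (any? (λ a → any? (λ b → a * s + b * t + 0 ≟ x) (upTo (suc x))) (upTo (suc x)))

  Rep-+ : ∀ {x y} → Rep x → Rep y → Rep (x + y)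
  Rep-+ (a , b , refl) (a′ , b′ , refl) = a + a′ , b + b′ , regroup a a′ b b′ s t
    where
    regroup : ∀ a a′ b b′ s t → (a + a′) * s + (b + b′) * t ≡ a * s + b * t + (a′ * s + b′ * t)
    regroup = solve-∀

  Rep-*s : ∀ a → Rep (a * s)
  Rep-*s a = a , 0 , +-identityʳ _

  #Rep : ℕ → ℕ
  #Rep = count Rep?

  #Rep-from : ℕ → ℕ → ℕ
  #Rep-from a = count (λ i → Rep? (a + i))

  #Rep-+ : ∀ a n → #Rep (a + n) ≡ #Rep a + #Rep-from a n
  #Rep-+ = count-+ Rep?

  #Rep-mono : ∀ {m n} → m ≤ n → #Rep m ≤ #Rep n
  #Rep-mono {m} {n} m≤n =
    subst (#Rep m ≤_) (trans (sym (#Rep-+ m (n ∸ m))) (cong #Rep (m+[n∸m]≡n m≤n))) (m≤m+n _ _)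

  #Rep-from-shift : ∀ {a b c} n → Rep c → c + a ≡ b → #Rep-from a n ≤ #Rep-from b n
  #Rep-from-shift {a} {c = c} n Rc refl =
    count-mono _ _ n λ {i} _ Ra+i → subst Rep (sym (+-assoc c a i)) (Rep-+ Rc Ra+i)

  #Rep-superadditive : ∀ {a} b → Rep a → #Rep a + #Rep b ≤ #Rep (a + b)
  #Rep-superadditive {a} b Ra =
    subst (#Rep a + #Rep b ≤_) (sym (#Rep-+ a b)) (+-monoʳ-≤ (#Rep a) (#Rep-from-shift b Ra (+-identityʳ a)))

  #Rep-superadditive-strict : ∀ {a b e} → Rep a → e < b → Rep (a + e) → ¬ Rep e →
                              #Rep a + #Rep b < #Rep (a + b)
  #Rep-superadditive-strict {a} {b} Ra e<b Ra+e ¬Re =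
    subst (#Rep a + #Rep b <_) (sym (#Rep-+ a b)) (+-monoʳ-< (#Rep a) (count-< _ _ b (λ _ → Rep-+ Ra) e<b ¬Re Ra+e))

  #Rep-suc : ∀ {m} → Rep m → #Rep (suc m) ≡ suc (#Rep m)
  #Rep-suc {m} Rm = trans (cong (#Rep m +_) (indicator-yes (Rep? m) Rm)) (+-comm (#Rep m) 1)

  #Rep-≤⇒≤ : ∀ {m n} → Rep m → #Rep n ≤ #Rep m → n ≤ m
  #Rep-≤⇒≤ {m} {n} Rm #n≤#m = ≮⇒≥ λ m<n →
    <⇒≱ (subst (#Rep m <_) (sym (#Rep-suc Rm)) ≤-refl) (≤-trans (#Rep-mono m<n) #n≤#m)

  Rep-<s⇒≡0 : s < t → ∀ {x} → Rep x → x < s → x ≡ 0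
  Rep-<s⇒≡0 _   (zero  , zero  , refl) _   = refl
  Rep-<s⇒≡0 _   (suc a , b     , refl) x<s = contradiction (≤-trans (m≤m+n s _) (m≤m+n _ _)) (<⇒≱ x<s)
  Rep-<s⇒≡0 s<t (zero  , suc b , refl) x<s = contradiction (m≤m+n t _) (<⇒≱ (<-trans x<s s<t))

  #Rep-s : s < t → #Rep s ≡ 1
  #Rep-s s<t = begin
    #Rep s                         ≡⟨ cong #Rep 1+[s∸1]≡s ⟨
    #Rep (1 + (s ∸ 1))             ≡⟨ #Rep-+ 1 (s ∸ 1) ⟩
    #Rep 1 + #Rep-from 1 (s ∸ 1)   ≡⟨ cong₂ _+_ (indicator-yes (Rep? 0) (0 , 0 , refl))
                                                 (count-≡0 _ (s ∸ 1) 1+i∉Rep) ⟩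
    1 + 0                          ∎
    where
    open ≡-Reasoning
    1+[s∸1]≡s : 1 + (s ∸ 1) ≡ s
    1+[s∸1]≡s = m+[n∸m]≡n (>-nonZero⁻¹ s)
    1+i∉Rep : ∀ {i} → i < s ∸ 1 → ¬ Rep (1 + i)
    1+i∉Rep i<s∸1 Rep1+i with () ← Rep-<s⇒≡0 s<t Rep1+i (subst (_ <_) 1+[s∸1]≡s (s≤s i<s∸1))

  t∸s∉Rep : 1 < s → Coprime s t → s < t → ¬ Rep (t ∸ s)
  t∸s∉Rep 1<s coprime s<t (a , zero , e) = <⇒≢ 1<s (sym (coprime (∣-refl , divides (suc a) t≡[1+a]s)))
    where
    t≡[1+a]s : t ≡ suc a * s
    t≡[1+a]s = begin
      t                  ≡⟨ m+[n∸m]≡n (<⇒≤ s<t) ⟨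
      s + (t ∸ s)        ≡⟨ cong (s +_) e ⟨
      s + (a * s + 0)    ≡⟨ cong (s +_) (+-identityʳ (a * s)) ⟩
      suc a * s          ∎
      where open ≡-Reasoning
  t∸s∉Rep _ _ s<t (a , suc b , e) =
    <⇒≱ (∸-monoʳ-< (>-nonZero⁻¹ s) (<⇒≤ s<t))
        (≤-trans (≤-trans (m≤m+n t (b * t)) (m≤n+m _ (a * s))) (≤-reflexive e))

  -- Superadditivity is strict at Y s + X s, thanks to (Y - 1) s + t with t - s not representable;
  -- this pays for the representable 0 < s lost when counting from s instead of from 0.
  #Rep-triple : 1 < s → Coprime s t → s < t → ∀ {X Y Z} → t < X * s → 1 ≤ Y → 1 ≤ Z →
                #Rep (X * s) + (#Rep (Y * s) + #Rep (Z * s)) ≤ #Rep (pred (X + (Y + Z)) * s)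
  #Rep-triple 1<s coprime s<t {X} {suc Y} {suc Z} t<Xs _ _ = begin
    #Rep Xs + (#Rep Ys + #Rep (s + Z * s))             ≡⟨ cong (λ n → #Rep Xs + (#Rep Ys + n)) #Rep[s+Zs] ⟩
    #Rep Xs + (#Rep Ys + suc (#Rep-from s (Z * s)))    ≡⟨ regroup (#Rep Xs) (#Rep Ys) _ ⟩
    suc (#Rep Ys + #Rep Xs) + #Rep-from s (Z * s)      ≤⟨ +-mono-≤ gain shift-by-[Y+X]s ⟩
    #Rep (Ys + Xs) + #Rep-from (Ys + Xs) (Z * s)       ≡⟨ #Rep-+ (Ys + Xs) (Z * s) ⟨
    #Rep (Ys + Xs + Z * s)                             ≡⟨ cong #Rep Ys+Xs+Zs≡ ⟩
    #Rep (pred (X + (suc Y + suc Z)) * s)              ∎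
    where
    open ≤-Reasoning
    Xs = X * s
    Ys = suc Y * s
    #Rep[s+Zs] : #Rep (s + Z * s) ≡ suc (#Rep-from s (Z * s))
    #Rep[s+Zs] = trans (#Rep-+ s (Z * s)) (cong (_+ #Rep-from s (Z * s)) (#Rep-s s<t))
    regroup : ∀ a b c → a + (b + suc c) ≡ suc (b + a) + c
    regroup = solve-∀
    Ys+[t∸s]≡Ys+t : Y * s + 1 * t ≡ Ys + (t ∸ s)
    Ys+[t∸s]≡Ys+t = begin-equality
      Y * s + 1 * t          ≡⟨ cong (Y * s +_) (trans (*-identityˡ t) (sym (m+[n∸m]≡n (<⇒≤ s<t)))) ⟩
      Y * s + (s + (t ∸ s))  ≡⟨ swap (Y * s) s (t ∸ s) ⟩
      Ys + (t ∸ s)           ∎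
      where
      swap : ∀ a b c → a + (b + c) ≡ b + a + c
      swap = solve-∀
    gain : #Rep Ys + #Rep Xs < #Rep (Ys + Xs)
    gain = #Rep-superadditive-strict (Rep-*s (suc Y)) (≤-<-trans (m∸n≤m t s) t<Xs)
             (Y , 1 , Ys+[t∸s]≡Ys+t) (t∸s∉Rep 1<s coprime s<t)
    shift-by-[Y+X]s : #Rep-from s (Z * s) ≤ #Rep-from (Ys + Xs) (Z * s)
    shift-by-[Y+X]s = #Rep-from-shift (Z * s) (Rep-*s (Y + X)) (distribute Y X s)
      where
      distribute : ∀ Y X s → (Y + X) * s + s ≡ suc Y * s + X * s
      distribute = solve-∀
    Ys+Xs+Zs≡ : Ys + Xs + Z * s ≡ pred (X + (suc Y + suc Z)) * s
    Ys+Xs+Zs≡ = trans (collect Y X Z s) (cong (λ n → pred n * s) (sym (+-suc X (Y + suc Z))))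
      where
      collect : ∀ Y X Z s → suc Y * s + X * s + Z * s ≡ (X + (Y + suc Z)) * s
      collect = solve-∀

  ∈-delta⁺ : ∀ {a b y g} → a * s + b * t + y ≡ g → 1 ≤ y → y ∈ delta s t g
  ∈-delta⁺ {a} {b} {suc z} e _ = ∈-filter⁺ _ (∈-map⁺ suc (∈-downFrom⁺ z<g)) (search⁺ {a} {b} e)
    where
    z<g : z < _
    z<g = ≤-trans (m≤n+m (suc z) _) (≤-reflexive e)

  ∈-delta⁻ : ∀ {y g} → y ∈ delta s t g → 1 ≤ y × ∃[ a ] ∃[ b ] a * s + b * t + y ≡ g
  ∈-delta⁻ {g = g} y∈ =
    let y∈range , search = ∈-filter⁻ _ {xs = map suc (downFrom g)} y∈
        _ , _ , y≡suc = ∈-map⁻ suc y∈range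
    in subst (1 ≤_) (sym y≡suc) (s≤s z≤n) , Any²⁻ search

  length-delta : ∀ g → length (delta s t g) ≡ #Rep g
  length-delta g = trans (length-filter-downFrom _ g) (count-reverse _ Rep? g λ i<g → mk⇔ (to i<g) (from i<g))
    where
    to : ∀ {i} → i < g → Any (λ a → Any (λ b → a * s + b * t + suc i ≡ g) (upTo (suc g))) (upTo (suc g)) →
         Rep (g ∸ suc i)
    to {i} _ search = let a , b , e = Any²⁻ search in
      a , b , trans (sym (m+n∸n≡m (a * s + b * t) (suc i))) (cong (_∸ suc i) e)
    from : ∀ {i} → i < g → Rep (g ∸ suc i) →
           Any (λ a → Any (λ b → a * s + b * t + suc i ≡ g) (upTo (suc g))) (upTo (suc g))
    from {i} i<g (a , b , e) = search⁺ {a} {b} (trans (cong (_+ suc i) e) (m∸n+n≡m i<g))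

  ∈-delta⇒residue : ∀ {y g} → y ∈ delta s t g → ∃[ a ] a * s < g × (g ∸ a * s) % t ≡ y % t
  ∈-delta⇒residue {y} {g} y∈ =
    let 1≤y , a , b , e = ∈-delta⁻ y∈
        as+[y+bt]≡g = trans (rearrange (a * s) (b * t) y) e
    in a
     , ≤-trans (m<m+n (a * s) 1≤y) (≤-trans (+-monoˡ-≤ y (m≤m+n (a * s) (b * t))) (≤-reflexive e))
     , trans (cong (λ n → (n ∸ a * s) % t) (sym as+[y+bt]≡g))
             (trans (cong (_% t) (m+n∸m≡n (a * s) (y + b * t))) ([m+kn]%n≡m%n y b t))
    where
    rearrange : ∀ u v w → u + (w + v) ≡ u + v + w
    rearrange = solve-∀

  ht : ℕ → ℕ
  ht g = height t (delta s t g)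

  ht≤t : ∀ g → ht g ≤ t
  ht≤t g = residues-≤-modulus t (delta s t g)

  ≤*s⇒ht≤ : ∀ {D m} → D ≤ m * s → ht D ≤ m
  ≤*s⇒ht≤ {D} {m} D≤ms = subst (ht D ≤_) (length-applyUpTo residue m) (residues-≤ t (delta s t D) Δ%t⊆)
    where
    residue : ℕ → ℕ
    residue a = (D ∸ a * s) % t
    Δ%t⊆ : map (_% t) (delta s t D) ⊆ applyUpTo residue m
    Δ%t⊆ r∈ with y , y∈ , refl ← ∈-map⁻ (_% t) r∈ with a , as<D , ≡y%t ← ∈-delta⇒residue y∈ =
      subst (_∈ applyUpTo residue m) ≡y%t (∈-applyUpTo⁺ residue (*-cancelʳ-< s a m (<-≤-trans as<D D≤ms)))

  ht-≥ : Coprime s t → ∀ {g m} → m ≤ t → (∀ {a} → a < m → a * s < g) → m ≤ ht g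
  ht-≥ coprime {g} {m} m≤t as<g =
    subst (_≤ ht g) (length-applyUpTo residue m)
      (residues-≥ t (delta s t g) (applyUpTo⁺₁ residue m distinct) ⊆Δ%t)
    where
    residue : ℕ → ℕ
    residue a = (g ∸ a * s) % t
    ⊆Δ%t : applyUpTo residue m ⊆ map (_% t) (delta s t g)
    ⊆Δ%t r∈ with a , a<m , refl ← ∈-applyUpTo⁻ residue r∈ =
      ∈-map⁺ (_% t) (∈-delta⁺ {a} {0} as+0t+[g∸as]≡g (m<n⇒0<n∸m (as<g a<m)))
      where
      as+0t+[g∸as]≡g : a * s + 0 * t + (g ∸ a * s) ≡ g
      as+0t+[g∸as]≡g = trans (cong (_+ (g ∸ a * s)) (+-identityʳ (a * s))) (m+[n∸m]≡n (<⇒≤ (as<g a<m)))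
    split : ∀ {i j} → i ≤ j → j < m → g ∸ i * s ≡ g ∸ j * s + (j ∸ i) * s
    split {i} {j} i≤j j<m = begin
      g ∸ i * s                        ≡⟨ cong (_∸ i * s) (m∸n+n≡m (<⇒≤ (as<g j<m))) ⟨
      g ∸ j * s + j * s ∸ i * s        ≡⟨ +-∸-assoc (g ∸ j * s) (*-monoˡ-≤ s i≤j) ⟩
      g ∸ j * s + (j * s ∸ i * s)      ≡⟨ cong (g ∸ j * s +_) (*-distribʳ-∸ s j i) ⟨
      g ∸ j * s + (j ∸ i) * s          ∎
      where open ≡-Reasoning
    distinct : ∀ {i j} → i < j → j < m → residue i ≢ residue j
    distinct {i} {j} i<j j<m eq = <⇒≱ (≤-<-trans (m∸n≤m j i) (<-≤-trans j<m m≤t)) (∣⇒≤ t∣j∸i)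
      where
      instance _ = >-nonZero (m<n⇒0<n∸m i<j)
      t∣[j∸i]s : t ∣ (j ∸ i) * s
      t∣[j∸i]s = [m+n]%d≡m%d⇒d∣n (g ∸ j * s) _ t (trans (cong (_% t) (sym (split (<⇒≤ i<j) j<m))) eq)
      t∣j∸i : t ∣ j ∸ i
      t∣j∸i = coprime-divisor (Coprime-sym coprime) (subst (t ∣_) (*-comm (j ∸ i) s) t∣[j∸i]s)

  ht-positive : Coprime s t → ∀ {g} → 1 ≤ g → 1 ≤ ht g
  ht-positive coprime 1≤g = ht-≥ coprime (>-nonZero⁻¹ t) λ { {zero} _ → 1≤g ; {suc _} (s≤s ()) }

  ≤-ht*s : Coprime s t → ∀ {g} → ht g < t → g ≤ ht g * s
  ≤-ht*s coprime {g} ht<t = ≮⇒≥ λ hs<g →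
    <⇒≱ ≤-refl (ht-≥ coprime ht<t λ a<1+h → ≤-<-trans (*-monoˡ-≤ s (s≤s⁻¹ a<1+h)) hs<g)

  width-≤1 : ∀ {g} → g ≤ t → width s (delta s t g) ≤ 1
  width-≤1 {g} g≤t = residues-≤ s (delta s t g) Δ%s⊆
    where
    Δ%s⊆ : map (_% s) (delta s t g) ⊆ [ g % s ]
    Δ%s⊆ r∈ with y , y∈ , refl ← ∈-map⁻ (_% s) r∈ with ∈-delta⁻ y∈
    ... | _ , a , zero , e = here (trans (sym ([m+kn]%n≡m%n y a s)) (cong (_% s) y+as≡g))
      where
      y+as≡g : y + a * s ≡ g
      y+as≡g = trans (+-comm y (a * s)) (trans (cong (_+ y) (sym (+-identityʳ (a * s)))) e)
    ... | 1≤y , a , suc b , e = contradiction g≤t (<⇒≱ (subst (_≤ g) (+-comm t 1) t+1≤g))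
      where
      t+1≤g : t + 1 ≤ g
      t+1≤g = ≤-trans (+-mono-≤ (≤-trans (m≤m+n t (b * t)) (m≤n+m _ (a * s))) 1≤y) (≤-reflexive e)

  sum-#Rep-≤ : Coprime s t → ∀ L → sum (map ht L) < t → sum (map #Rep L) ≤ #Rep (sum (map ht L) * s)
  sum-#Rep-≤ coprime []      _    = z≤n
  sum-#Rep-≤ coprime (x ∷ L) Σ<t = begin
    #Rep x + sum (map #Rep L)                    ≤⟨ +-mono-≤ (#Rep-mono (≤-ht*s coprime {x} (≤-<-trans (m≤m+n _ _) Σ<t)))
                                                             (sum-#Rep-≤ coprime L (≤-<-trans (m≤n+m _ _) Σ<t)) ⟩
    #Rep (ht x * s) + #Rep (sum (map ht L) * s)  ≤⟨ #Rep-superadditive _ (Rep-*s (ht x)) ⟩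
    #Rep (ht x * s + sum (map ht L) * s)         ≡⟨ cong #Rep (*-distribʳ-+ s (ht x) _) ⟨
    #Rep ((ht x + sum (map ht L)) * s)           ∎
    where open ≤-Reasoning

  ht-<-sum₃ : Coprime s t → s < t → ∀ {D x y z} zs → t < x → 1 ≤ y → 1 ≤ z →
              #Rep D ≤ sum (map #Rep (x ∷ y ∷ z ∷ zs)) → ht D < sum (map ht (x ∷ y ∷ z ∷ zs))
  ht-<-sum₃ coprime s<t {D} {x} {y} {z} zs t<x 1≤y 1≤z #D≤ with t <? sum (map ht (x ∷ y ∷ z ∷ zs))
  ... | yes t<H = ≤-<-trans (ht≤t D) t<H
  ... | no  t≮H = m≤pred[n]⇒suc[m]≤n {{>-nonZero (≤-trans 1≤X (m≤m+n X _))}} (≤*s⇒ht≤ D≤)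
    where
    X = ht x
    Y = ht y
    Z = sum (map ht (z ∷ zs))
    H≤t : X + (Y + Z) ≤ t
    H≤t = ≮⇒≥ t≮H
    1≤X : 1 ≤ X
    1≤X = ht-positive coprime (<-trans (>-nonZero⁻¹ t) t<x)
    1≤Y : 1 ≤ Y
    1≤Y = ht-positive coprime 1≤y
    1≤Z : 1 ≤ Z
    1≤Z = ≤-trans (ht-positive coprime 1≤z) (m≤m+n _ _)
    X<t : X < t
    X<t = <-≤-trans (m<m+n X (≤-trans 1≤Y (m≤m+n Y Z))) H≤t
    Y<t : Y < t
    Y<t = <-≤-trans (m<m+n Y 1≤Z) (≤-trans (m≤n+m _ X) H≤t)
    Z<t : Z < t
    Z<t = <-≤-trans (m<n+m Z 1≤Y) (≤-trans (m≤n+m _ X) H≤t)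
    x≤Xs : x ≤ X * s
    x≤Xs = ≤-ht*s coprime {x} X<t
    1<s : 1 < s
    1<s = ≰⇒> λ s≤1 → <⇒≱ (<-trans X<t t<x)
                            (≤-trans x≤Xs (≤-trans (*-monoʳ-≤ X s≤1) (≤-reflexive (*-identityʳ X))))
    D≤ : D ≤ pred (X + (Y + Z)) * s
    D≤ = #Rep-≤⇒≤ (Rep-*s (pred (X + (Y + Z)))) (begin
      #Rep D                                         ≤⟨ #D≤ ⟩
      #Rep x + (#Rep y + sum (map #Rep (z ∷ zs)))    ≤⟨ +-mono-≤ (#Rep-mono x≤Xs)
                                                          (+-mono-≤ (#Rep-mono (≤-ht*s coprime {y} Y<t))
                                                                    (sum-#Rep-≤ coprime (z ∷ zs) Z<t)) ⟩
      #Rep (X * s) + (#Rep (Y * s) + #Rep (Z * s))   ≤⟨ #Rep-triple 1<s coprime s<t {X} {Y} {Z}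
                                                                    (<-≤-trans t<x x≤Xs) 1≤Y 1≤Z ⟩
      #Rep (pred (X + (Y + Z)) * s)                  ∎)
      where open ≤-Reasoning

  ht-<-sum : Coprime s t → s < t → ∀ {D x} L → x ∈ L → t < x → 3 ≤ length L →
             (∀ {y} → y ∈ L → 1 ≤ y) →
             #Rep D ≡ sum (map #Rep L) → ht D < sum (map ht L)
  ht-<-sum coprime s<t {D} {x} L x∈L t<x 3≤|L| L≥1 #D≡ = split (∈⇒↭∷ x∈L)
    where
    split : ∃[ rest ] L ↭ x ∷ rest → ht D < sum (map ht L)
    split (y ∷ z ∷ zs , L↭) =
      subst (ht D <_) (sum-↭ (map⁺ ht (↭-sym L↭)))
        (ht-<-sum₃ coprime s<t {D} zs t<x (L≥1 (∈-resp-↭ (↭-sym L↭) (there (here refl))))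
                                 (L≥1 (∈-resp-↭ (↭-sym L↭) (there (there (here refl)))))
                                 (≤-reflexive (trans #D≡ (sum-↭ (map⁺ #Rep L↭)))))
    split ([] , L↭)     = contradiction (subst (3 ≤_) (↭-length L↭) 3≤|L|) λ { (s≤s ()) }
    split (_ ∷ [] , L↭) = contradiction (subst (3 ≤_) (↭-length L↭) 3≤|L|) λ { (s≤s (s≤s ())) }

lemma5p4 : (s t : ℕ) .{{_ : NonZero s}} .{{_ : NonZero t}} → s < t → Coprime s t →
    (k : ℕ) → 2 < k → (g : Fin k → ℕ) → (∀ i → 1 ≤ g i) →
    (∀ i j → i ≢ j → ∀ x → x ∈ delta s t (g i) → x ∈ delta s t (g j) → ⊥) →
    (∃[ i ] 1 < width s (delta s t (g i))) →
    (D : ℕ) → IsMDelta s t (sum (map (λ i → length (delta s t (g i))) (allFin k))) D →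
    height t (delta s t D) < sum (map (λ i → height t (delta s t (g i))) (allFin k))
lemma5p4 s t s<t coprime k 2<k g g≥1 _ (j , 1<width) D (_ , |ΔD|≡n , _) =
  subst (ht s t D <_) (cong sum (sym (map-∘ (allFin k))))
    (ht-<-sum s t coprime s<t {D} (map g (allFin k)) (∈-map⁺ g (∈-allFin j)) t<gj 3≤k positive #D≡)
  where
  t<gj : t < g j
  t<gj = ≰⇒> λ gj≤t → <⇒≱ 1<width (width-≤1 s t gj≤t)
  3≤k : 3 ≤ length (map g (allFin k))
  3≤k = subst (3 ≤_) (sym (trans (length-map g (allFin k)) (length-tabulate id))) 2<k
  positive : ∀ {x} → x ∈ map g (allFin k) → 1 ≤ x
  positive x∈ with i , _ , refl ← ∈-map⁻ g x∈ = g≥1 i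
  #D≡ : #Rep s t D ≡ sum (map (#Rep s t) (map g (allFin k)))
  #D≡ = trans (sym (length-delta s t D))
          (trans |ΔD|≡n (cong sum (trans (map-cong (λ i → length-delta s t (g i)) (allFin k)) (map-∘ (allFin k)))))
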